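{- Let $d\in\mathbb{N}$ and let $G$ be a finite graph with vertices $v_0,v_1$ whose distance is at most $d/2$ and at least three; let $C=C_d(v_0,v_1,G)$ and let $\varphi$ be the map defined in the context. Let $o$ be an edge set of $G$ that is generated by a family $\mathcal{O}$ of cycles of $G$ of length at most $d$. Assume that $o$ has degree zero at $v_1$ and degree two at $v_0$, and let $x$ and $y$ be the vertices with $v_0x,v_0y\in o$. Then the support of $\varphi(\mathcal{O})$ is an edge set of $C$ that has even degree at every vertex of $C$ except for $x$ and $y$, where it has odd degree.
   Context: All graphs are finite, without loops or parallel edges. An edge set $o$ of $G$ is generated by a family $\mathcal{O}$ of cycles if, in the edge space $\mathbb{F}_2^{E(G)}$, the characteristic vector of $o$ is the sum of the characteristic vectors of the edge sets of the cycles in $\mathcal{O}$. For a vertex $v$, the ball $D_d(v)$ is the subgraph of $G$ consisting of all vertices and edges lying on some closed walk of length at most $d$ containing $v$. For $X\subseteq V(G)$, $N(X)$ is the set of vertices outside $X$ with a neighbour in $X$. The connectivity graph $C=C_d(v_0,v_1,G)$ has vertex set $N(\{v_0,v_1\})$, and $xy$ is an edge if there is an $x$–$y$ path in $D_d(v_i)-v_0-v_1$ for some $i\in\{0,1\}$. Let $\mathcal{E}=\mathbb{F}_2^{E(C)}$. The map $\varphi$ from cycles $o$ of $G$ of length at most $d$ to $\mathcal{E}$ is defined by: if $o$ contains neither $v_0$ nor $v_1$, then $\varphi(o)=0$; if $o$ contains exactly one of $v_0,v_1$, it contains exactly two edges with an end vertex in $\{v_0,v_1\}$, and if $x,y$ are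 their other end vertices then $xy\in E(C)$ and $\varphi(o)$ is the characteristic vector of $\{xy\}$; if $o$ contains both $v_0,v_1$, it is the union of two $v_0$–$v_1$ paths $P^1,P^2$, and with $x^j$ the second vertex and $y^j$ the second-to-last vertex of $P^j$, $\varphi(o)$ is the characteristic vector of $\{x^1y^1,x^2y^2\}$ (these are edges of $C$). For a family $\mathcal{O}$, $\varphi(\mathcal{O})$ is the $\mathbb{F}_2$-sum of $\varphi(o)$ over $o\in\mathcal{O}$. -}

module Defs where

open import Data.Nat using (ℕ; zero; suc; _+_; _*_; _∸_; _≤_; _<_)
open import Data.Nat.DivMod using (_%_; m%n<n)
open import Data.Fin using (Fin; zero; suc; toℕ; fromℕ<; inject₁; fromℕ; _≟_)
open import Data.Fin.Properties using (any?)
import Data.Bool as B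
open import Data.Bool using (Bool; true; false; _∨_; _∧_; _xor_; if_then_else_)
open import Data.List using (List; []; _∷_; foldr; map)
open import Data.Product using (Σ; ∃; _×_; _,_; proj₁; proj₂)
open import Data.Sum using (_⊎_)
open import Relation.Nullary using (¬_; Dec; yes; no; does)
open import Relation.Binary.PropositionalEquality using (_≡_; _≢_)

record Graph (n : ℕ) : Set where
  field
    adj     : Fin n → Fin n → Bool
    adj-sym : ∀ x y → adj x y ≡ adj y x
    adj-irr : ∀ x → adj x x ≡ false
open Graph public

module _ {n : ℕ} (G : Graph n) where

  Adj : Fin n → Fin n → Set
  Adj x y = adj G x y ≡ true

  SamePair : Fin n → Fin n → Fin n → Fin n → Set
  SamePair p q a b = (p ≡ a × q ≡ b) ⊎ (p ≡ b × q ≡ a)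

  record Walk (ℓ : ℕ) : Set where
    field
      vtx  : Fin (suc ℓ) → Fin n
      step : ∀ (i : Fin ℓ) → Adj (vtx (inject₁ i)) (vtx (suc i))
  open Walk public

  start end : ∀ {ℓ} → Walk ℓ → Fin n
  start w = vtx w zero
  end {ℓ} w = vtx w (fromℕ ℓ)

  OnWalk : ∀ {ℓ} → Walk ℓ → Fin n → Set
  OnWalk {ℓ} w z = ∃ λ (i : Fin (suc ℓ)) → vtx w i ≡ z

  EdgeOnWalk : ∀ {ℓ} → Walk ℓ → Fin n → Fin n → Set
  EdgeOnWalk {ℓ} w p q =
    ∃ λ (i : Fin ℓ) → SamePair p q (vtx w (inject₁ i)) (vtx w (suc i))

  IsPath : ∀ {ℓ} → Walk ℓ → Set
  IsPath {ℓ} w = ∀ (i j : Fin (suc ℓ)) → vtx w i ≡ vtx w j → i ≡ j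

  DistLe : Fin n → Fin n → ℕ → Set
  DistLe u v k = Σ ℕ λ ℓ → ℓ ≤ k × Σ (Walk ℓ) λ w → start w ≡ u × end w ≡ v

  -- The ball D_d(v): vertices and edges lying on a closed walk of length
  -- at most d containing v.

  ClosedWalkThrough : ℕ → Fin n → Set
  ClosedWalkThrough d v =
    Σ ℕ λ ℓ → ℓ ≤ d × Σ (Walk ℓ) λ w → start w ≡ end w × OnWalk w v

  InBallV : ℕ → Fin n → Fin n → Set
  InBallV d v z =
    Σ ℕ λ ℓ → ℓ ≤ d × Σ (Walk ℓ) λ w →
      start w ≡ end w × OnWalk w v × OnWalk w z

  InBallE : ℕ → Fin n → Fin n → Fin n → Set
  InBallE d v p q =
    Σ ℕ λ ℓ → ℓ ≤ d × Σ (Walk ℓ) λ w →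
      start w ≡ end w × OnWalk w v × EdgeOnWalk w p q

  CVertex : Fin n → Fin n → Fin n → Set
  CVertex v0 v1 u = u ≢ v0 × u ≢ v1 × (Adj u v0 ⊎ Adj u v1)

  PathInBallMinus : ℕ → Fin n → Fin n → Fin n → Fin n → Fin n → Set
  PathInBallMinus d v v0 v1 x y =
    Σ ℕ λ ℓ → Σ (Walk ℓ) λ w →
      IsPath w × start w ≡ x × end w ≡ y ×
      (∀ i → InBallV d v (vtx w i) × vtx w i ≢ v0 × vtx w i ≢ v1) ×
      (∀ (i : Fin ℓ) → InBallE d v (vtx w (inject₁ i)) (vtx w (suc i)))

  -- edges of C (C is a simple graph, so x ≠ y)
  CEdge : ℕ → Fin n → Fin n → Fin n → Fin n → Set
  CEdge d v0 v1 x y =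
    CVertex v0 v1 x × CVertex v0 v1 y × x ≢ y ×
    (PathInBallMinus d v0 v0 v1 x y ⊎ PathInBallMinus d v1 v0 v1 x y)

  cycLen : ℕ → ℕ
  cycLen m = 3 + m

  nxt : ∀ {m} → Fin (cycLen m) → Fin (cycLen m)
  nxt {m} i = fromℕ< (m%n<n (suc (toℕ i)) (cycLen m))

  prv : ∀ {m} → Fin (cycLen m) → Fin (cycLen m)
  prv {m} i = fromℕ< (m%n<n (toℕ i + (2 + m)) (cycLen m))

  record Cycle : Set where
    field
      m      : ℕ
      cv     : Fin (cycLen m) → Fin n
      cv-inj : ∀ i j → cv i ≡ cv j → i ≡ j
      cv-adj : ∀ i → Adj (cv i) (cv (nxt i))
  open Cycle public

  len : Cycle → ℕ
  len c = cycLen (m c)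

  pairB : Fin n → Fin n → Fin n → Fin n → Bool
  pairB p q a b = (does (p ≟ a) ∧ does (q ≟ b)) ∨ (does (p ≟ b) ∧ does (q ≟ a))

  -- characteristic vector (element of F2^{E(G)}, represented as a
  -- function on vertex pairs) of the edge set of a cycle
  cycleVec : Cycle → Fin n → Fin n → Bool
  cycleVec c p q = does (any? λ i → pairB p q (cv c i) (cv c (nxt i)) B.≟ true)

  sumCycles : List Cycle → Fin n → Fin n → Bool
  sumCycles 𝒪 p q = foldr _xor_ false (map (λ c → cycleVec c p q) 𝒪)

  GeneratedBy : (Fin n → Fin n → Bool) → List Cycle → Set
  GeneratedBy o 𝒪 = ∀ p q → o p q ≡ sumCycles 𝒪 p q

  -- The map φ (values in E = F2^{E(C)}, represented as functions on
  -- vertex pairs; the characteristic vector of {ab} is pairB _ _ a b).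

  private
    find : (c : Cycle) (v : Fin n) → Dec (∃ λ i → cv c i ≡ v)
    find c v = any? λ i → cv c i ≟ v

  φ : Fin n → Fin n → Cycle → Fin n → Fin n → Bool
  φ v0 v1 c p q with find c v0 | find c v1
  ... | no _ | no _ = false
  ... | yes (i , _) | no _ = pairB p q (cv c (prv i)) (cv c (nxt i))
  ... | no _ | yes (j , _) = pairB p q (cv c (prv j)) (cv c (nxt j))
  -- both: P¹ goes forward from v0 (x¹ = nxt i, y¹ = prv j),
  --       P² goes backward from v0 (x² = prv i, y² = nxt j);
  -- characteristic vector of the set {x¹y¹, x²y²}
  ... | yes (i , _) | yes (j , _) =
        pairB p q (cv c (nxt i)) (cv c (prv j)) ∨
        pairB p q (cv c (prv i)) (cv c (nxt j))

  φFam : Fin n → Fin n → List Cycle → Fin n → Fin n → Bool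
  φFam v0 v1 𝒪 p q = foldr _xor_ false (map (λ c → φ v0 v1 c p q) 𝒪)

  countFin : ∀ {k} → (Fin k → Bool) → ℕ
  countFin {zero} f = 0
  countFin {suc k} f = (if f zero then 1 else 0) + countFin (λ i → f (suc i))

  degree : (Fin n → Fin n → Bool) → Fin n → ℕ
  degree e u = countFin (λ w → e u w)

-- Both claims are checked one cycle o ∈ 𝒪 at a time and then summed over F₂.
-- If o passes through v0 (say), φ(o) consists of chords of C joining the
-- neighbours of v0 and v1 on o.  Each chord is witnessed by the arc of o
-- between its ends: that arc avoids v0 and v1, and it lies in D_d(v) for
-- each v ∈ {v0, v1} on o, because o itself is a closed walk of length ≤ d.
-- Since dist(v0, v1) ≥ 3, v1 is at least three steps from v0 on o in both
-- directions, so the two chords have distinct ends and are distinct edges.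
-- Their ends are exactly the o-neighbours of v0 and v1, so the φ(o)-degree
-- of u has the parity of [uv0 ∈ o] + [uv1 ∈ o]; summed over 𝒪 this is
-- o(v0u) + o(v1u), which is odd exactly at u ∈ {x, y}.

module Submission where

open import Defs
open import Data.Nat using (ℕ; _≤_; _*_; _%_)
open import Data.Fin using (Fin)
open import Data.Bool using (Bool; true; false)
open import Data.List using (List)
open import Data.List.Relation.Unary.All using (All)
open import Data.Product using (Σ; _×_; _,_)
open import Data.Sum using (_⊎_)
open import Relation.Nullary using (¬_)
open import Relation.Binary.PropositionalEquality using (_≡_; _≢_)

open import Algebra.Bundles using (CommutativeRing)
import Data.Bool as B
open import Data.Bool using (not; _∨_; _∧_; _xor_; if_then_else_)
open import Data.Bool.Properties
  using (xor-comm; xor-identityʳ; ∧-identityʳ; ∨-zeroʳ; ¬-not; ⇔→≡; xor-∧-commutativeRing)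
open import Data.Fin using (zero; suc; toℕ; fromℕ<; fromℕ; inject₁; opposite; _≟_)
open import Data.Fin.Properties
  using (toℕ-injective; toℕ-fromℕ<; toℕ-fromℕ; toℕ-inject₁; toℕ<n; opposite-involutive; any?)
open import Data.List using ([]; _∷_)
open import Data.List.Relation.Unary.All using ([]; _∷_)
open import Data.Nat using (zero; suc; _+_; _∸_; _<_; z≤n; s≤s; NonZero)
open import Data.Nat.DivMod using (m%n<n; m%n%n≡m%n; %-distribˡ-+; [m+n]%n≡m%n; m<n⇒m%n≡m)
open import Data.Nat.Properties
  using (≤-refl; ≤-trans; <⇒≤; <⇒≢; <-trans; n<1+n; m<1+n⇒m≤n; +-comm; +-assoc; +-suc; +-identityʳ; m+[n∸m]≡n)
open import Data.Product using (∃; proj₁; proj₂)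
open import Data.Sum using (inj₁; inj₂; [_,_]′)
import Data.Product as Prod
import Data.Sum as Sum
open import Function using (_∘_; mk⇔)
open import Relation.Nullary using (Dec; yes; no; does; contradiction)
open import Relation.Nullary.Decidable using (dec-true; dec-false)
open import Relation.Binary.PropositionalEquality
  using (refl; sym; trans; cong; cong₂; subst; subst₂; ≢-sym; module ≡-Reasoning)

open import Algebra.Properties.CommutativeSemigroup
  (CommutativeRing.+-commutativeSemigroup xor-∧-commutativeRing) using (interchange)

-- Parity of Boolean functions on Fin k

does⇒ : ∀ {p} {P : Set p} (P? : Dec P) → does P? ≡ true → P
does⇒ (yes p) _ = p

∨≡true⇒ : ∀ a b → a ∨ b ≡ true → a ≡ true ⊎ b ≡ true
∨≡true⇒ true  b _ = inj₁ refl
∨≡true⇒ false b e = inj₂ e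

∧≡true⇒ : ∀ a b → a ∧ b ≡ true → a ≡ true × b ≡ true
∧≡true⇒ true true _ = refl , refl

xor≡true⇒ : ∀ a b → a xor b ≡ true → a ≡ true ⊎ b ≡ true
xor≡true⇒ true  b _ = inj₁ refl
xor≡true⇒ false b e = inj₂ e

parity : ∀ {k} → (Fin k → Bool) → Bool
parity {zero}  f = false
parity {suc k} f = f zero xor parity (f ∘ suc)

parity-cong : ∀ {k} {f g : Fin k → Bool} → (∀ i → f i ≡ g i) → parity f ≡ parity g
parity-cong {zero}  f≗g = refl
parity-cong {suc k} f≗g = cong₂ _xor_ (f≗g zero) (parity-cong (f≗g ∘ suc))

parity-false : ∀ k → parity {k} (λ _ → false) ≡ false
parity-false zero    = refl
parity-false (suc k) = parity-false k

parity-xor : ∀ {k} (f g : Fin k → Bool) →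
  parity (λ i → f i xor g i) ≡ parity f xor parity g
parity-xor {zero}  f g = refl
parity-xor {suc k} f g =
  trans (cong ((f zero xor g zero) xor_) (parity-xor (f ∘ suc) (g ∘ suc)))
        (interchange (f zero) (g zero) _ _)

parity-∨ : ∀ {k} (f g : Fin k → Bool) → (∀ i → f i ≡ true → g i ≢ true) →
  parity (λ i → f i ∨ g i) ≡ parity f xor parity g
parity-∨ f g disjoint = trans (parity-cong λ i → ∨≡xor (disjoint i)) (parity-xor f g)
  where
  ∨≡xor : ∀ {a b} → (a ≡ true → b ≢ true) → a ∨ b ≡ a xor b
  ∨≡xor {true}  {true}  h = contradiction refl (h refl)
  ∨≡xor {true}  {false} h = refl
  ∨≡xor {false}         h = refl

parity-∧ˡ : ∀ {k} b (f : Fin k → Bool) → parity (λ i → b ∧ f i) ≡ b ∧ parity f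
parity-∧ˡ true  f = refl
parity-∧ˡ {k} false f = parity-false k

parity-≟ : ∀ {k} (a : Fin k) → parity (λ i → does (i ≟ a)) ≡ true
parity-≟ {suc k} zero    = cong not (parity-false k)
parity-≟ {suc k} (suc a) = parity-≟ a

countFin-%2 : ∀ {n} (G : Graph n) {k} (f : Fin k → Bool) →
  countFin G f % 2 ≡ (if parity f then 1 else 0)
countFin-%2 G {zero}  f = refl
countFin-%2 G {suc k} f with f zero
... | false = countFin-%2 G (f ∘ suc)
... | true  = begin
  (1 + countFin G (f ∘ suc)) % 2                 ≡⟨ %-distribˡ-+ 1 (countFin G (f ∘ suc)) 2 ⟩
  (1 + countFin G (f ∘ suc) % 2) % 2             ≡⟨ cong (λ z → (1 + z) % 2) (countFin-%2 G (f ∘ suc)) ⟩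
  (1 + (if parity (f ∘ suc) then 1 else 0)) % 2  ≡⟨ flip (parity (f ∘ suc)) ⟩
  (if not (parity (f ∘ suc)) then 1 else 0)      ∎
  where
  open ≡-Reasoning
  flip : ∀ b → (1 + (if b then 1 else 0)) % 2 ≡ (if not b then 1 else 0)
  flip true  = refl
  flip false = refl

-- Cyclic shifts on Fin L

module _ {L : ℕ} .{{_ : NonZero L}} where

  [m%n+o]%n≡[m+o]%n : ∀ x k → (x % L + k) % L ≡ (x + k) % L
  [m%n+o]%n≡[m+o]%n x k = begin
    (x % L + k) % L          ≡⟨ %-distribˡ-+ (x % L) k L ⟩
    (x % L % L + k % L) % L  ≡⟨ cong (λ z → (z + k % L) % L) (m%n%n≡m%n x L) ⟩
    (x % L + k % L) % L      ≡⟨ %-distribˡ-+ x k L ⟨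
    (x + k) % L              ∎
    where open ≡-Reasoning

  [m+n%o]%o≡[m+n]%o : ∀ k x → (k + x % L) % L ≡ (k + x) % L
  [m+n%o]%o≡[m+n]%o k x = begin
    (k + x % L) % L  ≡⟨ cong (_% L) (+-comm k (x % L)) ⟩
    (x % L + k) % L  ≡⟨ [m%n+o]%n≡[m+o]%n x k ⟩
    (x + k) % L      ≡⟨ cong (_% L) (+-comm x k) ⟩
    (k + x) % L      ∎
    where open ≡-Reasoning

  shift : Fin L → ℕ → Fin L
  shift a t = fromℕ< (m%n<n (toℕ a + t) L)

  toℕ-shift : ∀ a t → toℕ (shift a t) ≡ (toℕ a + t) % L
  toℕ-shift a t = toℕ-fromℕ< (m%n<n (toℕ a + t) L)

  toℕ-shift-< : ∀ a t → toℕ a + t < L → toℕ (shift a t) ≡ toℕ a + t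
  toℕ-shift-< a t lt = trans (toℕ-shift a t) (m<n⇒m%n≡m lt)

  shift-zero : ∀ a → shift a 0 ≡ a
  shift-zero a = toℕ-injective (begin
    toℕ (shift a 0)  ≡⟨ toℕ-shift-< a 0 (subst (_< L) (sym (+-identityʳ (toℕ a))) (toℕ<n a)) ⟩
    toℕ a + 0        ≡⟨ +-identityʳ (toℕ a) ⟩
    toℕ a            ∎)
    where open ≡-Reasoning

  shift-shift : ∀ a t u → shift (shift a t) u ≡ shift a (t + u)
  shift-shift a t u = toℕ-injective (begin
    toℕ (shift (shift a t) u)    ≡⟨ toℕ-shift (shift a t) u ⟩
    (toℕ (shift a t) + u) % L    ≡⟨ cong (λ z → (z + u) % L) (toℕ-shift a t) ⟩
    ((toℕ a + t) % L + u) % L    ≡⟨ [m%n+o]%n≡[m+o]%n (toℕ a + t) u ⟩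
    (toℕ a + t + u) % L          ≡⟨ cong (_% L) (+-assoc (toℕ a) t u) ⟩
    (toℕ a + (t + u)) % L        ≡⟨ toℕ-shift a (t + u) ⟨
    toℕ (shift a (t + u))        ∎)
    where open ≡-Reasoning

  shift-+L : ∀ a t → shift a (t + L) ≡ shift a t
  shift-+L a t = toℕ-injective (begin
    toℕ (shift a (t + L))    ≡⟨ toℕ-shift a (t + L) ⟩
    (toℕ a + (t + L)) % L    ≡⟨ cong (_% L) (+-assoc (toℕ a) t L) ⟨
    (toℕ a + t + L) % L      ≡⟨ [m+n]%n≡m%n (toℕ a + t) L ⟩
    (toℕ a + t) % L          ≡⟨ toℕ-shift a t ⟨
    toℕ (shift a t)          ∎)
    where open ≡-Reasoning

  private
    +-unshift : ∀ a x → x + toℕ a + (L ∸ toℕ a) ≡ x + L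
    +-unshift a x = trans (+-assoc x (toℕ a) _) (cong (x +_) (m+[n∸m]≡n (<⇒≤ (toℕ<n a))))

  shift-injective : ∀ a {t u} → t < L → u < L → shift a t ≡ shift a u → t ≡ u
  shift-injective a {t} {u} t<L u<L eq = begin
    t                                        ≡⟨ unshift t t<L ⟨
    ((toℕ a + t) % L + (L ∸ toℕ a)) % L      ≡⟨ cong (λ z → (z + (L ∸ toℕ a)) % L) same ⟩
    ((toℕ a + u) % L + (L ∸ toℕ a)) % L      ≡⟨ unshift u u<L ⟩
    u                                        ∎
    where
    open ≡-Reasoning
    same : (toℕ a + t) % L ≡ (toℕ a + u) % L
    same = trans (sym (toℕ-shift a t)) (trans (cong toℕ eq) (toℕ-shift a u))
    unshift : ∀ s → s < L → ((toℕ a + s) % L + (L ∸ toℕ a)) % L ≡ s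
    unshift s s<L = begin
      ((toℕ a + s) % L + (L ∸ toℕ a)) % L  ≡⟨ [m%n+o]%n≡[m+o]%n (toℕ a + s) (L ∸ toℕ a) ⟩
      (toℕ a + s + (L ∸ toℕ a)) % L        ≡⟨ cong (λ z → (z + (L ∸ toℕ a)) % L) (+-comm (toℕ a) s) ⟩
      (s + toℕ a + (L ∸ toℕ a)) % L        ≡⟨ cong (_% L) (+-unshift a s) ⟩
      (s + L) % L                          ≡⟨ [m+n]%n≡m%n s L ⟩
      s % L                                ≡⟨ m<n⇒m%n≡m s<L ⟩
      s                                    ∎

  shift-surjective : ∀ a b → Σ ℕ λ s → s < L × shift a s ≡ b
  shift-surjective a b = s , m%n<n (toℕ b + (L ∸ toℕ a)) L , toℕ-injective (begin
    toℕ (shift a s)                       ≡⟨ toℕ-shift a s ⟩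
    (toℕ a + s) % L                       ≡⟨ [m+n%o]%o≡[m+n]%o (toℕ a) (toℕ b + (L ∸ toℕ a)) ⟩
    (toℕ a + (toℕ b + (L ∸ toℕ a))) % L   ≡⟨ cong (_% L) (+-assoc (toℕ a) (toℕ b) _) ⟨
    (toℕ a + toℕ b + (L ∸ toℕ a)) % L     ≡⟨ cong (λ z → (z + (L ∸ toℕ a)) % L) (+-comm (toℕ a) (toℕ b)) ⟩
    (toℕ b + toℕ a + (L ∸ toℕ a)) % L     ≡⟨ cong (_% L) (+-unshift a (toℕ b)) ⟩
    (toℕ b + L) % L                       ≡⟨ [m+n]%n≡m%n (toℕ b) L ⟩
    toℕ b % L                             ≡⟨ m<n⇒m%n≡m (toℕ<n b) ⟩
    toℕ b                                 ∎)
    where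
    open ≡-Reasoning
    s = (toℕ b + (L ∸ toℕ a)) % L

-- Walks, paths in balls and edges of the connectivity graph

opposite-inject₁ : ∀ {ℓ} (i : Fin ℓ) → opposite (inject₁ i) ≡ suc (opposite i)
opposite-inject₁ {suc ℓ} zero    = refl
opposite-inject₁ {suc ℓ} (suc i) = cong inject₁ (opposite-inject₁ i)

module _ {n : ℕ} (G : Graph n) where

  Adj-sym : ∀ {x y} → Adj G x y → Adj G y x
  Adj-sym {x} {y} e = trans (adj-sym G y x) e

  pairB⇒SamePair : ∀ {p q a b} → pairB G p q a b ≡ true → SamePair G p q a b
  pairB⇒SamePair {p} {q} {a} {b} e = Sum.map (both (p ≟ a) (q ≟ b)) (both (p ≟ b) (q ≟ a)) (∨≡true⇒ _ _ e)
    where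
    both : ∀ {P Q : Set} (P? : Dec P) (Q? : Dec Q) → does P? ∧ does Q? ≡ true → P × Q
    both P? Q? e = let (p , q) = ∧≡true⇒ _ _ e in does⇒ P? p , does⇒ Q? q

  SamePair⇒pairB : ∀ {p q a b} → SamePair G p q a b → pairB G p q a b ≡ true
  SamePair⇒pairB {p} {q} {a} {b} (inj₁ (p≡a , q≡b)) =
    cong₂ (λ x y → (x ∧ y) ∨ (does (p ≟ b) ∧ does (q ≟ a))) (dec-true (p ≟ a) p≡a) (dec-true (q ≟ b) q≡b)
  SamePair⇒pairB {p} {q} {a} {b} (inj₂ (p≡b , q≡a)) =
    trans (cong₂ (λ x y → (does (p ≟ a) ∧ does (q ≟ b)) ∨ (x ∧ y)) (dec-true (p ≟ b) p≡b) (dec-true (q ≟ a) q≡a))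
          (∨-zeroʳ _)

  parity-pairB : ∀ u {a b} → a ≢ b →
    parity (λ w → pairB G u w a b) ≡ does (u ≟ a) xor does (u ≟ b)
  parity-pairB u {a} {b} a≢b = begin
    parity (λ w → pairB G u w a b)
      ≡⟨ parity-∨ (λ w → does (u ≟ a) ∧ does (w ≟ b)) (λ w → does (u ≟ b) ∧ does (w ≟ a)) disjoint ⟩
    parity (λ w → does (u ≟ a) ∧ does (w ≟ b)) xor parity (λ w → does (u ≟ b) ∧ does (w ≟ a))
      ≡⟨ cong₂ _xor_ (parity-∧ˡ (does (u ≟ a)) (λ w → does (w ≟ b))) (parity-∧ˡ (does (u ≟ b)) (λ w → does (w ≟ a))) ⟩
    (does (u ≟ a) ∧ parity (λ w → does (w ≟ b))) xor (does (u ≟ b) ∧ parity (λ w → does (w ≟ a)))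
      ≡⟨ cong₂ (λ x y → (does (u ≟ a) ∧ x) xor (does (u ≟ b) ∧ y)) (parity-≟ b) (parity-≟ a) ⟩
    (does (u ≟ a) ∧ true) xor (does (u ≟ b) ∧ true)
      ≡⟨ cong₂ _xor_ (∧-identityʳ (does (u ≟ a))) (∧-identityʳ (does (u ≟ b))) ⟩
    does (u ≟ a) xor does (u ≟ b) ∎
    where
    open ≡-Reasoning
    disjoint : ∀ w → does (u ≟ a) ∧ does (w ≟ b) ≡ true → does (u ≟ b) ∧ does (w ≟ a) ≢ true
    disjoint w e₁ e₂ =
      a≢b (trans (sym (does⇒ (u ≟ a) (proj₁ (∧≡true⇒ _ _ e₁)))) (does⇒ (u ≟ b) (proj₁ (∧≡true⇒ _ _ e₂))))

  reverse : ∀ {ℓ} → Walk G ℓ → Walk G ℓ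
  reverse w = record
    { vtx  = vtx w ∘ opposite
    ; step = λ i → subst (λ k → Adj G (vtx w k) (vtx w (inject₁ (opposite i))))
                         (sym (opposite-inject₁ i)) (Adj-sym (step w (opposite i)))
    }

  end-reverse : ∀ {ℓ} (w : Walk G ℓ) → end G (reverse w) ≡ start G w
  end-reverse w = cong (vtx w) (opposite-involutive zero)

  DistLe-sym : ∀ {u v k} → DistLe G u v k → DistLe G v u k
  DistLe-sym (ℓ , ℓ≤k , w , refl , refl) = ℓ , ℓ≤k , reverse w , refl , end-reverse w

  InBallE-sym : ∀ {d v p q} → InBallE G d v p q → InBallE G d v q p
  InBallE-sym (ℓ , ℓ≤d , w , closed , on , i , same) =
    ℓ , ℓ≤d , w , closed , on , i , Sum.swap (Sum.map Prod.swap Prod.swap same)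

  PathInBallMinus-reverse : ∀ {d v v0 v1 x y} →
    PathInBallMinus G d v v0 v1 x y → PathInBallMinus G d v v0 v1 y x
  PathInBallMinus-reverse (ℓ , w , isPath , refl , refl , avoids , edges) =
    ℓ , reverse w , isPath′ , refl , end-reverse w , avoids ∘ opposite , edges′
    where
    isPath′ : IsPath G (reverse w)
    isPath′ i j e = begin
      i                       ≡⟨ opposite-involutive i ⟨
      opposite (opposite i)   ≡⟨ cong opposite (isPath (opposite i) (opposite j) e) ⟩
      opposite (opposite j)   ≡⟨ opposite-involutive j ⟩
      j                       ∎
      where open ≡-Reasoning
    edges′ : ∀ i → InBallE G _ _ (vtx w (opposite (inject₁ i))) (vtx w (inject₁ (opposite i)))
    edges′ i = subst (λ k → InBallE G _ _ (vtx w k) (vtx w (inject₁ (opposite i))))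
                     (sym (opposite-inject₁ i)) (InBallE-sym (edges (opposite i)))

  PathInBallMinus-swap : ∀ {d v v0 v1 x y} →
    PathInBallMinus G d v v0 v1 x y → PathInBallMinus G d v v1 v0 x y
  PathInBallMinus-swap (ℓ , w , isPath , s , e , avoids , edges) =
    ℓ , w , isPath , s , e , (λ i → let (inBall , ≢v0 , ≢v1) = avoids i in inBall , ≢v1 , ≢v0) , edges

  PathInBallMinus-ends : ∀ {d v v0 v1 x y} → PathInBallMinus G d v v0 v1 x y →
    (x ≢ v0 × x ≢ v1) × (y ≢ v0 × y ≢ v1)
  PathInBallMinus-ends (ℓ , w , _ , refl , refl , avoids , _) =
    proj₂ (avoids zero) , proj₂ (avoids (fromℕ ℓ))

  module _ {d : ℕ} {v0 v1 : Fin n} where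

    CEdge-of-path : ∀ {x y} →
      PathInBallMinus G d v0 v0 v1 x y ⊎ PathInBallMinus G d v1 v0 v1 x y →
      (Adj G x v0 ⊎ Adj G x v1) → (Adj G y v0 ⊎ Adj G y v1) → x ≢ y →
      CEdge G d v0 v1 x y
    CEdge-of-path path adj-x adj-y x≢y with [ PathInBallMinus-ends , PathInBallMinus-ends ]′ path
    ... | (x≢v0 , x≢v1) , (y≢v0 , y≢v1) = (x≢v0 , x≢v1 , adj-x) , (y≢v0 , y≢v1 , adj-y) , x≢y , path

    CEdge-sym : ∀ {x y} → CEdge G d v0 v1 x y → CEdge G d v0 v1 y x
    CEdge-sym (cx , cy , x≢y , path) =
      cy , cx , ≢-sym x≢y , Sum.map PathInBallMinus-reverse PathInBallMinus-reverse path

    CEdge-of-pairB : ∀ {x y p q} → CEdge G d v0 v1 x y → pairB G p q x y ≡ true → CEdge G d v0 v1 p q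
    CEdge-of-pairB {x} {y} {p} {q} xy e with pairB⇒SamePair {p} {q} {x} {y} e
    ... | inj₁ (refl , refl) = xy
    ... | inj₂ (refl , refl) = CEdge-sym xy

  CEdge-swap : ∀ {d v0 v1 x y} → CEdge G d v0 v1 x y → CEdge G d v1 v0 x y
  CEdge-swap ((x≢v0 , x≢v1 , adj-x) , (y≢v0 , y≢v1 , adj-y) , x≢y , path) =
    (x≢v1 , x≢v0 , Sum.swap adj-x) , (y≢v1 , y≢v0 , Sum.swap adj-y) , x≢y ,
    Sum.swap (Sum.map PathInBallMinus-swap PathInBallMinus-swap path)

  -- Arcs of a cycle

  module _ (c : Cycle G) where

    private
      L : ℕ
      L = len G c

      edge? : ∀ v u → Dec (∃ λ k → pairB G v u (cv c k) (cv c (nxt G k)) ≡ true)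
      edge? v u = any? λ k → pairB G v u (cv c k) (cv c (nxt G k)) B.≟ true

    nxt-shift : ∀ a t → nxt G (shift a t) ≡ shift a (suc t)
    nxt-shift a t = toℕ-injective (begin
      toℕ (nxt G (shift a t))     ≡⟨ toℕ-fromℕ< (m%n<n (suc (toℕ (shift a t))) L) ⟩
      (1 + toℕ (shift a t)) % L   ≡⟨ cong (λ z → (1 + z) % L) (toℕ-shift a t) ⟩
      (1 + (toℕ a + t) % L) % L   ≡⟨ [m+n%o]%o≡[m+n]%o {L = L} 1 (toℕ a + t) ⟩
      (1 + (toℕ a + t)) % L       ≡⟨ cong (_% L) (+-suc (toℕ a) t) ⟨
      (toℕ a + suc t) % L         ≡⟨ toℕ-shift a (suc t) ⟨
      toℕ (shift a (suc t))       ∎)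
      where open ≡-Reasoning

    nxt≡shift1 : ∀ a → nxt G a ≡ shift a 1
    nxt≡shift1 a = trans (cong (nxt G) (sym (shift-zero a))) (nxt-shift a 0)

    shift-nxt : ∀ a t → shift (nxt G a) t ≡ shift a (suc t)
    shift-nxt a t = trans (cong (λ b → shift b t) (nxt≡shift1 a)) (shift-shift a 1 t)

    -- prv G a unfolds to shift a (2 + m c), a shift by L ∸ 1.
    prv-shift : ∀ a t → prv G (shift a (suc t)) ≡ shift a t
    prv-shift a t = begin
      shift (shift a (suc t)) (2 + m c)  ≡⟨ shift-shift a (suc t) (2 + m c) ⟩
      shift a (suc t + (2 + m c))        ≡⟨ cong (shift a) (+-suc t (2 + m c)) ⟨
      shift a (t + L)                    ≡⟨ shift-+L a t ⟩
      shift a t                          ∎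
      where open ≡-Reasoning

    nxt-prv : ∀ a → nxt G (prv G a) ≡ a
    nxt-prv a = trans (nxt-shift a (2 + m c)) (trans (shift-+L a 0) (shift-zero a))

    prv-nxt : ∀ a → prv G (nxt G a) ≡ a
    prv-nxt a = trans (cong (prv G) (nxt≡shift1 a)) (trans (prv-shift a 0) (shift-zero a))

    cv-shift-≢ : ∀ a {t u} → t < L → u < L → t ≢ u → cv c (shift a t) ≢ cv c (shift a u)
    cv-shift-≢ a t<L u<L t≢u e = t≢u (shift-injective a t<L u<L (cv-inj c _ _ e))

    cv-shift-suc-≢ : ∀ a {t} → suc t < L → cv c (shift a (suc t)) ≢ cv c a
    cv-shift-suc-≢ a lt e = cv-shift-≢ a lt (s≤s z≤n) (λ ()) (trans e (cong (cv c) (sym (shift-zero a))))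

    nxt≢prv : ∀ a → cv c (nxt G a) ≢ cv c (prv G a)
    nxt≢prv a e = cv-shift-≢ a (s≤s (s≤s z≤n)) ≤-refl (λ ()) (trans (cong (cv c) (sym (nxt≡shift1 a))) e)

    nxt-adj : ∀ a → Adj G (cv c (nxt G a)) (cv c a)
    nxt-adj a = Adj-sym (cv-adj c a)

    prv-adj : ∀ a → Adj G (cv c (prv G a)) (cv c a)
    prv-adj a = subst (Adj G (cv c (prv G a)) ∘ cv c) (nxt-prv a) (cv-adj c (prv G a))

    cycleWalk : Fin L → (k : ℕ) → Walk G k
    cycleWalk a k = record
      { vtx  = λ t → cv c (shift a (toℕ t))
      ; step = λ i → subst (λ t → Adj G (cv c (shift a t)) (cv c (shift a (suc (toℕ i)))))
                           (sym (toℕ-inject₁ i)) (cycle-step (toℕ i))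
      }
      where
      cycle-step : ∀ t → Adj G (cv c (shift a t)) (cv c (shift a (suc t)))
      cycle-step t = subst (Adj G (cv c (shift a t)) ∘ cv c) (nxt-shift a t) (cv-adj c (shift a t))

    start-cycleWalk : ∀ a k → start G (cycleWalk a k) ≡ cv c a
    start-cycleWalk a k = cong (cv c) (shift-zero a)

    end-cycleWalk : ∀ a k → end G (cycleWalk a k) ≡ cv c (shift a k)
    end-cycleWalk a k = cong (cv c ∘ shift a) (toℕ-fromℕ k)

    cycle-DistLe : ∀ a {s k} → s ≤ k → DistLe G (cv c a) (cv c (shift a s)) k
    cycle-DistLe a {s} s≤k = s , s≤k , cycleWalk a s , start-cycleWalk a s , end-cycleWalk a s

    data Ahead≥3 (a : Fin L) : Fin L → Set where
      ahead : ∀ r → 3 + r < L → Ahead≥3 a (shift a (3 + r))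

    farOnCycle : ∀ a b → ¬ DistLe G (cv c a) (cv c b) 2 → Ahead≥3 a b
    farOnCycle a b far = classify (shift-surjective a b)
      where
      near : ∀ {s} → s ≤ 2 → shift a s ≡ b → DistLe G (cv c a) (cv c b) 2
      near s≤2 e = subst (λ z → DistLe G (cv c a) (cv c z) 2) e (cycle-DistLe a s≤2)
      classify : (Σ ℕ λ s → s < L × shift a s ≡ b) → Ahead≥3 a b
      classify (0 , _ , e)                  = contradiction (near z≤n e) far
      classify (1 , _ , e)                  = contradiction (near (s≤s z≤n) e) far
      classify (2 , _ , e)                  = contradiction (near (s≤s (s≤s z≤n)) e) far
      classify (suc (suc (suc r)) , lt , e) = subst (Ahead≥3 a) e (ahead r lt)

    Ahead≥3⇒≢ : ∀ {a b} → Ahead≥3 a b → a ≢ b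
    Ahead≥3⇒≢ {a} (ahead r lt) e = contradiction (shift-injective a (s≤s z≤n) lt (trans (shift-zero a) e)) λ ()

    arcEnds-≢ : ∀ {a b} → Ahead≥3 a b → cv c (nxt G a) ≢ cv c (prv G b)
    arcEnds-≢ {a} (ahead r lt) e =
      cv-shift-≢ a (s≤s (s≤s z≤n)) (<-trans (n<1+n (2 + r)) lt) (λ ())
        (trans (cong (cv c) (sym (nxt≡shift1 a))) (trans e (cong (cv c) (prv-shift a (2 + r)))))

    cycleVec-off : ∀ {v} u → ¬ (∃ λ k → cv c k ≡ v) → cycleVec G c v u ≡ false
    cycleVec-off {v} u v∉c = dec-false (edge? v u) λ (k , e) →
      [ (λ (v≡ , _) → v∉c (k , sym v≡)) , (λ (v≡ , _) → v∉c (nxt G k , sym v≡)) ]′ (pairB⇒SamePair {v} {u} e)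

    cycleVec-on : ∀ {a v} u → cv c a ≡ v →
      cycleVec G c v u ≡ does (u ≟ cv c (prv G a)) xor does (u ≟ cv c (nxt G a))
    cycleVec-on {a} u refl = ⇔→≡ (mk⇔ to from)
      where
      to : cycleVec G c (cv c a) u ≡ true → does (u ≟ cv c (prv G a)) xor does (u ≟ cv c (nxt G a)) ≡ true
      to e with does⇒ (edge? (cv c a) u) e
      ... | k , pk with pairB⇒SamePair {cv c a} {u} pk
      ... | inj₁ (a≡k , u≡) = cong₂ _xor_ (dec-false (u ≟ _) λ u≡prv → nxt≢prv a (trans (sym u≡nxt) u≡prv))
                                          (dec-true (u ≟ _) u≡nxt)
        where
        u≡nxt : u ≡ cv c (nxt G a)
        u≡nxt = trans u≡ (cong (cv c ∘ nxt G) (cv-inj c k a (sym a≡k)))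
      ... | inj₂ (a≡nxt , u≡) = cong₂ _xor_ (dec-true (u ≟ _) u≡prv)
                                            (dec-false (u ≟ _) λ u≡nxt → nxt≢prv a (trans (sym u≡nxt) u≡prv))
        where
        u≡prv : u ≡ cv c (prv G a)
        u≡prv = trans u≡ (cong (cv c) (trans (sym (prv-nxt k)) (cong (prv G) (cv-inj c _ _ (sym a≡nxt)))))
      from : does (u ≟ cv c (prv G a)) xor does (u ≟ cv c (nxt G a)) ≡ true → cycleVec G c (cv c a) u ≡ true
      from e with xor≡true⇒ _ _ e
      ... | inj₁ d = dec-true (edge? (cv c a) u) (prv G a , SamePair⇒pairB {cv c a} {u} (inj₂ (cong (cv c) (sym (nxt-prv a)) , does⇒ (u ≟ _) d)))
      ... | inj₂ d = dec-true (edge? (cv c a) u) (a , SamePair⇒pairB {cv c a} {u} (inj₁ (refl , does⇒ (u ≟ _) d)))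

    module _ {d : ℕ} (short : len G c ≤ d) {a : Fin L} {v : Fin n} (a↦v : cv c a ≡ v) where

      private
        tour : Walk G L
        tour = cycleWalk a L

        tour-closed : start G tour ≡ end G tour
        tour-closed = begin
          start G tour        ≡⟨ start-cycleWalk a L ⟩
          cv c a              ≡⟨ cong (cv c) (trans (shift-+L a 0) (shift-zero a)) ⟨
          cv c (shift a L)    ≡⟨ end-cycleWalk a L ⟨
          end G tour          ∎
          where open ≡-Reasoning

        position : ∀ b → ∃ λ (k : Fin L) → shift a (toℕ k) ≡ b
        position b with shift-surjective a b
        ... | s , s<L , e = fromℕ< s<L , trans (cong (shift a) (toℕ-fromℕ< s<L)) e

        vertex-on-tour : ∀ b → OnWalk G tour (cv c b)
        vertex-on-tour b with position b
        ... | k , e = inject₁ k , cong (cv c) (trans (cong (shift a) (toℕ-inject₁ k)) e)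

        edge-on-tour : ∀ b → EdgeOnWalk G tour (cv c b) (cv c (nxt G b))
        edge-on-tour b with position b
        ... | k , e = k , inj₁ (cong (cv c) (sym (trans (cong (shift a) (toℕ-inject₁ k)) e)) ,
                                cong (cv c) (trans (cong (nxt G) (sym e)) (nxt-shift a (toℕ k))))

        centre-on-tour : OnWalk G tour v
        centre-on-tour = subst (OnWalk G tour) a↦v (vertex-on-tour a)

      cycle-InBallV : ∀ b → InBallV G d v (cv c b)
      cycle-InBallV b = L , short , tour , tour-closed , centre-on-tour , vertex-on-tour b

      cycle-InBallE : ∀ b → InBallE G d v (cv c b) (cv c (nxt G b))
      cycle-InBallE b = L , short , tour , tour-closed , centre-on-tour , edge-on-tour b

      arcPath : ∀ {v0 v1} b k → k < L →
        (∀ t → t ≤ k → cv c (shift b t) ≢ v0 × cv c (shift b t) ≢ v1) →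
        PathInBallMinus G d v v0 v1 (cv c b) (cv c (shift b k))
      arcPath b k k<L avoids =
        k , cycleWalk b k , isPath , start-cycleWalk b k , end-cycleWalk b k ,
        (λ i → cycle-InBallV (shift b (toℕ i)) , avoids (toℕ i) (m<1+n⇒m≤n (toℕ<n i))) , edges
        where
        isPath : IsPath G (cycleWalk b k)
        isPath i j e = toℕ-injective (shift-injective b (≤-trans (toℕ<n i) k<L) (≤-trans (toℕ<n j) k<L) (cv-inj c _ _ e))
        edges : ∀ (i : Fin k) → InBallE G d v (cv c (shift b (toℕ (inject₁ i)))) (cv c (shift b (suc (toℕ i))))
        edges i = subst₂ (λ s t → InBallE G d v (cv c s) (cv c t))
                         (cong (shift b) (sym (toℕ-inject₁ i))) (nxt-shift b (toℕ i))
                         (cycle-InBallE (shift b (toℕ i)))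

      innerArcPath : ∀ {v0 v1} b k → suc k < L →
        (∀ t → t ≤ k → cv c (shift b (suc t)) ≢ v0 × cv c (shift b (suc t)) ≢ v1) →
        PathInBallMinus G d v v0 v1 (cv c (nxt G b)) (cv c (shift b (suc k)))
      innerArcPath {v0} {v1} b k lt avoids =
        subst (PathInBallMinus G d v v0 v1 (cv c (nxt G b))) (cong (cv c) (shift-nxt b k))
          (arcPath (nxt G b) k (<⇒≤ lt) λ t t≤k →
            subst (λ s → cv c s ≢ v0 × cv c s ≢ v1) (sym (shift-nxt b t)) (avoids t t≤k))

      aroundEdge : ∀ {w} → ¬ (∃ λ k → cv c k ≡ w) → CEdge G d v w (cv c (nxt G a)) (cv c (prv G a))
      aroundEdge w∉c =
        CEdge-of-path (inj₁ path) (inj₁ (subst (Adj G _) a↦v (nxt-adj a)))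
          (inj₁ (subst (Adj G _) a↦v (prv-adj a))) (nxt≢prv a)
        where
        path = innerArcPath a (suc (m c)) ≤-refl λ t t≤ →
          (λ e → cv-shift-suc-≢ a (s≤s (s≤s t≤)) (trans e (sym a↦v))) , (λ e → w∉c (_ , e))

      arcEdge : ∀ {b w} → cv c b ≡ w → Ahead≥3 a b → CEdge G d v w (cv c (nxt G a)) (cv c (prv G b))
      arcEdge {w = w} b↦w a→b@(ahead r lt) =
        CEdge-of-path (inj₁ path) (inj₁ (subst (Adj G _) a↦v (nxt-adj a)))
          (inj₂ (subst (Adj G _) b↦w (prv-adj _))) (arcEnds-≢ a→b)
        where
        avoids : ∀ t → t ≤ suc r → cv c (shift a (suc t)) ≢ v × cv c (shift a (suc t)) ≢ w
        avoids t t≤ = (λ e → cv-shift-suc-≢ a bound (trans e (sym a↦v))) ,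
                      (λ e → cv-shift-≢ a bound lt (<⇒≢ (s≤s (s≤s t≤))) (trans e (sym b↦w)))
          where
          bound : suc t < L
          bound = <-trans (s≤s (s≤s t≤)) lt
        path : PathInBallMinus G d v v w (cv c (nxt G a)) (cv c (prv G (shift a (3 + r))))
        path = subst (PathInBallMinus G d v v w (cv c (nxt G a))) (cong (cv c) (sym (prv-shift a (2 + r))))
                 (innerArcPath a (suc r) (<⇒≤ lt) avoids)

  -- The map φ when dist(v0, v1) ≥ 3

  module _ (v0 v1 : Fin n) (far : ¬ DistLe G v0 v1 2) where

    module TwoPaths (c : Cycle G) {i j} (i↦v0 : cv c i ≡ v0) (j↦v1 : cv c j ≡ v1) where

      forward : Ahead≥3 c i j
      forward = farOnCycle c i j (far ∘ subst₂ (λ x y → DistLe G x y 2) i↦v0 j↦v1)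

      backward : Ahead≥3 c j i
      backward = farOnCycle c j i (far ∘ DistLe-sym ∘ subst₂ (λ x y → DistLe G x y 2) j↦v1 i↦v0)

      edge₁ : ∀ {d} → len G c ≤ d → CEdge G d v0 v1 (cv c (nxt G i)) (cv c (prv G j))
      edge₁ short = arcEdge c short i↦v0 j↦v1 forward

      edge₂ : ∀ {d} → len G c ≤ d → CEdge G d v0 v1 (cv c (prv G i)) (cv c (nxt G j))
      edge₂ short = CEdge-sym (CEdge-swap (arcEdge c short j↦v1 i↦v0 backward))

      nxt≢nxt : cv c (nxt G i) ≢ cv c (nxt G j)
      nxt≢nxt e = Ahead≥3⇒≢ c forward (begin
        i                  ≡⟨ prv-nxt c i ⟨
        prv G (nxt G i)    ≡⟨ cong (prv G) (cv-inj c _ _ e) ⟩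
        prv G (nxt G j)    ≡⟨ prv-nxt c j ⟩
        j                  ∎)
        where open ≡-Reasoning

    φ-support : ∀ {d} c → len G c ≤ d → ∀ p q → φ G v0 v1 c p q ≡ true → CEdge G d v0 v1 p q
    φ-support c short p q e with any? (λ k → cv c k ≟ v0) | any? (λ k → cv c k ≟ v1)
    ... | no _         | no _         = contradiction e λ ()
    ... | yes (i , i↦v0) | no v1∉c    = CEdge-of-pairB (CEdge-sym (aroundEdge c short i↦v0 v1∉c)) e
    ... | no v0∉c      | yes (j , j↦v1) = CEdge-of-pairB (CEdge-sym (CEdge-swap (aroundEdge c short j↦v1 v0∉c))) e
    ... | yes (i , i↦v0) | yes (j , j↦v1) =
      [ CEdge-of-pairB (edge₁ short) , CEdge-of-pairB (edge₂ short) ]′ (∨≡true⇒ _ _ e)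
      where open TwoPaths c i↦v0 j↦v1

    φ-parity : ∀ c u → parity (λ w → φ G v0 v1 c u w) ≡ cycleVec G c v0 u xor cycleVec G c v1 u
    φ-parity c u with any? (λ k → cv c k ≟ v0) | any? (λ k → cv c k ≟ v1)
    ... | no v0∉c | no v1∉c =
      trans (parity-false n) (sym (cong₂ _xor_ (cycleVec-off c u v0∉c) (cycleVec-off c u v1∉c)))
    ... | yes (i , i↦v0) | no v1∉c = begin
      parity (λ w → pairB G u w (cv c (prv G i)) (cv c (nxt G i)))
        ≡⟨ parity-pairB u (≢-sym (nxt≢prv c i)) ⟩
      does (u ≟ cv c (prv G i)) xor does (u ≟ cv c (nxt G i))
        ≡⟨ cycleVec-on c u i↦v0 ⟨
      cycleVec G c v0 u
        ≡⟨ xor-identityʳ _ ⟨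
      cycleVec G c v0 u xor false
        ≡⟨ cong (cycleVec G c v0 u xor_) (cycleVec-off c u v1∉c) ⟨
      cycleVec G c v0 u xor cycleVec G c v1 u ∎
      where open ≡-Reasoning
    ... | no v0∉c | yes (j , j↦v1) = begin
      parity (λ w → pairB G u w (cv c (prv G j)) (cv c (nxt G j)))
        ≡⟨ parity-pairB u (≢-sym (nxt≢prv c j)) ⟩
      does (u ≟ cv c (prv G j)) xor does (u ≟ cv c (nxt G j))
        ≡⟨ cycleVec-on c u j↦v1 ⟨
      cycleVec G c v1 u
        ≡⟨ cong (_xor cycleVec G c v1 u) (cycleVec-off c u v0∉c) ⟨
      cycleVec G c v0 u xor cycleVec G c v1 u ∎
      where open ≡-Reasoning
    ... | yes (i , i↦v0) | yes (j , j↦v1) = begin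
      parity (λ w → pairB G u w x₁ y₁ ∨ pairB G u w x₂ y₂)
        ≡⟨ parity-∨ (λ w → pairB G u w x₁ y₁) (λ w → pairB G u w x₂ y₂) disjoint ⟩
      parity (λ w → pairB G u w x₁ y₁) xor parity (λ w → pairB G u w x₂ y₂)
        ≡⟨ cong₂ _xor_ (parity-pairB u (arcEnds-≢ c forward)) (parity-pairB u (≢-sym (arcEnds-≢ c backward))) ⟩
      (δ x₁ xor δ y₁) xor (δ x₂ xor δ y₂)
        ≡⟨ interchange (δ x₁) (δ y₁) (δ x₂) (δ y₂) ⟩
      (δ x₁ xor δ x₂) xor (δ y₁ xor δ y₂)
        ≡⟨ cong (_xor (δ y₁ xor δ y₂)) (xor-comm (δ x₁) (δ x₂)) ⟩
      (δ x₂ xor δ x₁) xor (δ y₁ xor δ y₂)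
        ≡⟨ cong₂ _xor_ (cycleVec-on c u i↦v0) (cycleVec-on c u j↦v1) ⟨
      cycleVec G c v0 u xor cycleVec G c v1 u ∎
      where
      open ≡-Reasoning
      open TwoPaths c i↦v0 j↦v1
      x₁ = cv c (nxt G i)
      y₁ = cv c (prv G j)
      x₂ = cv c (prv G i)
      y₂ = cv c (nxt G j)
      δ : Fin n → Bool
      δ z = does (u ≟ z)
      disjoint : ∀ w → pairB G u w x₁ y₁ ≡ true → pairB G u w x₂ y₂ ≢ true
      disjoint w e₁ e₂ with pairB⇒SamePair {u} {w} e₁ | pairB⇒SamePair {u} {w} e₂
      ... | inj₁ (u≡x₁ , _) | inj₁ (u≡x₂ , _) = nxt≢prv c i (trans (sym u≡x₁) u≡x₂)
      ... | inj₁ (u≡x₁ , _) | inj₂ (u≡y₂ , _) = nxt≢nxt (trans (sym u≡x₁) u≡y₂)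
      ... | inj₂ (_ , w≡x₁) | inj₁ (_ , w≡y₂) = nxt≢nxt (trans (sym w≡x₁) w≡y₂)
      ... | inj₂ (_ , w≡x₁) | inj₂ (_ , w≡x₂) = nxt≢prv c i (trans (sym w≡x₁) w≡x₂)

    φFam-support : ∀ {d} 𝒪 → All (λ c → len G c ≤ d) 𝒪 →
      ∀ p q → φFam G v0 v1 𝒪 p q ≡ true → CEdge G d v0 v1 p q
    φFam-support (c ∷ 𝒪) (short ∷ shorts) p q e =
      [ φ-support c short p q , φFam-support 𝒪 shorts p q ]′ (xor≡true⇒ _ _ e)

    φFam-parity : ∀ 𝒪 u →
      parity (λ w → φFam G v0 v1 𝒪 u w) ≡ sumCycles G 𝒪 v0 u xor sumCycles G 𝒪 v1 u
    φFam-parity []       u = parity-false n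
    φFam-parity (c ∷ 𝒪) u = begin
      parity (λ w → φ G v0 v1 c u w xor φFam G v0 v1 𝒪 u w)
        ≡⟨ parity-xor (λ w → φ G v0 v1 c u w) (λ w → φFam G v0 v1 𝒪 u w) ⟩
      parity (λ w → φ G v0 v1 c u w) xor parity (λ w → φFam G v0 v1 𝒪 u w)
        ≡⟨ cong₂ _xor_ (φ-parity c u) (φFam-parity 𝒪 u) ⟩
      (cycleVec G c v0 u xor cycleVec G c v1 u) xor (sumCycles G 𝒪 v0 u xor sumCycles G 𝒪 v1 u)
        ≡⟨ interchange (cycleVec G c v0 u) (cycleVec G c v1 u) _ _ ⟩
      sumCycles G (c ∷ 𝒪) v0 u xor sumCycles G (c ∷ 𝒪) v1 u ∎
      where open ≡-Reasoning

corollary3p9 : (d n : ℕ) (G : Graph n) (v0 v1 : Fin n) →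
    (Σ ℕ λ ℓ → 2 * ℓ ≤ d × DistLe G v0 v1 ℓ) →
    ¬ DistLe G v0 v1 2 →
    (o : Fin n → Fin n → Bool) (𝒪 : List (Cycle G)) →
    All (λ c → len G c ≤ d) 𝒪 →
    GeneratedBy G o 𝒪 →
    (∀ w → o v1 w ≡ false) →
    (x y : Fin n) → x ≢ y → o v0 x ≡ true → o v0 y ≡ true →
    (∀ w → o v0 w ≡ true → w ≡ x ⊎ w ≡ y) →
    (∀ p q → φFam G v0 v1 𝒪 p q ≡ true → CEdge G d v0 v1 p q) ×
    (degree G (φFam G v0 v1 𝒪) x % 2 ≡ 1) ×
    (degree G (φFam G v0 v1 𝒪) y % 2 ≡ 1) ×
    (∀ u → CVertex G v0 v1 u → u ≢ x → u ≢ y →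
      degree G (φFam G v0 v1 𝒪) u % 2 ≡ 0)
corollary3p9 d n G v0 v1 _ far o 𝒪 shorts generated o-v1 x y _ o-v0x o-v0y o-v0 =
  φFam-support G v0 v1 far 𝒪 shorts , degree-%2 o-v0x , degree-%2 o-v0y ,
  λ u _ u≢x u≢y → degree-%2 (¬-not λ e → [ u≢x , u≢y ]′ (o-v0 u e))
  where
  degree-%2 : ∀ {u b} → o v0 u ≡ b → degree G (φFam G v0 v1 𝒪) u % 2 ≡ (if b then 1 else 0)
  degree-%2 {u} {b} o-v0u = trans (countFin-%2 G (φFam G v0 v1 𝒪 u)) (cong (λ z → if z then 1 else 0) (begin
    parity (φFam G v0 v1 𝒪 u)                          ≡⟨ φFam-parity G v0 v1 far 𝒪 u ⟩
    sumCycles G 𝒪 v0 u xor sumCycles G 𝒪 v1 u          ≡⟨ cong₂ _xor_ (generated v0 u) (generated v1 u) ⟨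
    o v0 u xor o v1 u                                  ≡⟨ cong₂ _xor_ o-v0u (o-v1 u) ⟩
    b xor false                                        ≡⟨ xor-identityʳ b ⟩
    b                                                  ∎))
    where open ≡-Reasoning
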